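{- For all integers $n\geq 1$ and $k\geq 0$, the number of permutations of $[n]$ with exactly $k$ exterior peaks equals the number of increasing trees on $[n]$ with exactly $2k+1$ vertices of even degree.
   Context: For a permutation $\pi=\pi_1\pi_2\cdots\pi_n$ of $[n]=\{1,\ldots,n\}$, an index $i$ is an exterior peak if either $1<i<n$ and $\pi_{i-1}<\pi_i>\pi_{i+1}$, or $i=1$ (with $n\geq 2$) and $\pi_1>\pi_2$. An increasing tree on $[n]$ is a rooted tree with vertex set $\{0,1,\ldots,n\}$, rooted at $0$, in which labels increase along every path starting from the root. The degree of a vertex is the number of its children; vertices of even degree include all leaves and may include the root $0$. -}

module Defs where

open import Data.Nat using (ℕ; zero; suc; _+_; _*_; _<_; _<?_; _≤?_)
open import Data.Nat.Divisibility using (_∣?_)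
open import Data.Fin using (Fin; toℕ)
open import Data.Fin.Properties using () renaming (_≟_ to _≟ᶠ_)
open import Data.List using (List; []; _∷_; length; filter; map; concatMap)
open import Data.Vec using (Vec; []; _∷_; toList; lookup)
open import Data.Vec.Relation.Unary.All using (All)
import Data.Vec.Relation.Unary.All as VAll
open import Data.Fin using () renaming (_≟_ to _≟F_)
import Data.List as L
open import Data.List.Relation.Unary.Unique.Propositional using (Unique)
import Data.List.Relation.Unary.Unique.DecPropositional as UDec
open import Relation.Nullary using (Dec; does)
open import Relation.Unary using (Decidable)
open import Relation.Binary.PropositionalEquality using (_≡_)
open import Data.Bool using (Bool; true; false; if_then_else_; _∧_)
open import Data.Nat.Base using (_<ᵇ_)

count : ∀ {a p} {A : Set a} {P : A → Set p} → Decidable P → List A → ℕ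
count P? xs = length (filter P? xs)

allVecs : ∀ {a} {A : Set a} → List A → (m : ℕ) → List (Vec A m)
allVecs xs zero = [] ∷ []
allVecs xs (suc m) = concatMap (λ x → map (x ∷_) (allVecs xs m)) xs

-- Permutations of [n], written in one-line notation π₁ π₂ ⋯ πₙ.
-- The value j ∈ [n] is represented by (j - 1) : Fin n; this shift does
-- not affect comparisons.  A word is a permutation iff its entries are
-- pairwise distinct (length n, values in [n]).

IsPerm : ∀ {n} → Vec (Fin n) n → Set
IsPerm π = Unique (toList π)

isPerm? : ∀ {n} → Decidable (IsPerm {n})
isPerm? π = UDec.unique? _≟F_ (toList π)

interiorPeaks : List ℕ → ℕ
interiorPeaks (a ∷ b ∷ c ∷ r) =
  (if (a <ᵇ b) ∧ (c <ᵇ b) then 1 else 0) + interiorPeaks (b ∷ c ∷ r)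
interiorPeaks _ = 0

exteriorPeaksList : List ℕ → ℕ
exteriorPeaksList (a ∷ b ∷ r) = (if b <ᵇ a then 1 else 0) + interiorPeaks (a ∷ b ∷ r)
exteriorPeaksList _ = 0

exteriorPeaks : ∀ {n} → Vec (Fin n) n → ℕ
exteriorPeaks π = exteriorPeaksList (L.map toN (toList π))
  where toN = toℕ

numPermsWithExtPeaks : ℕ → ℕ → ℕ
numPermsWithExtPeaks n k =
  count (λ π → exteriorPeaks π Data.Nat.≟ k)
        (filter isPerm? (allVecs (L.allFin n) n))
  where import Data.Nat

-- Increasing trees on [n]: rooted trees on vertex set {0,1,…,n},
-- rooted at 0, labels increasing along every path from the root.
-- Such a (non-plane, unordered) tree is determined by, and determines,
-- its parent map: each non-root vertex v ∈ {1,…,n} has a parent p(v)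
-- with p(v) < v; conversely any such map is the parent map of a unique
-- increasing tree.  We represent a tree by the vector
--   (p(1), p(2), …, p(n)),  entry at position i : Fin n being p(i+1) ∈ {0..n}.

IsIncreasingParentMap : ∀ {n} → Vec (Fin (suc n)) n → Set
IsIncreasingParentMap {n} p = ∀ (i : Fin n) → toℕ (lookup p i) < suc (toℕ i)

isIncreasingParentMap? : ∀ {n} → Decidable (IsIncreasingParentMap {n})
isIncreasingParentMap? {n} p =
  Data.Fin.Properties.all? (λ i → toℕ (lookup p i) <? suc (toℕ i))
  where import Data.Fin.Properties

-- degree (number of children) of vertex v ∈ {0..n}
degree : ∀ {n} → Vec (Fin (suc n)) n → Fin (suc n) → ℕ
degree {n} p v = count (λ i → lookup p i ≟F v) (L.allFin n)

evenDegreeVertices : ∀ {n} → Vec (Fin (suc n)) n → ℕ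
evenDegreeVertices {n} p = count (λ v → 2 ∣? degree p v) (L.allFin (suc n))

numIncTreesWithEvenDeg : ℕ → ℕ → ℕ
numIncTreesWithEvenDeg n m =
  count (λ p → evenDegreeVertices p Data.Nat.≟ m)
        (filter isIncreasingParentMap? (allVecs (L.allFin (suc n)) n))
  where import Data.Nat

-- Both sides satisfy the same recurrence in n. Inserting n + 1 into the n + 1 gaps of a
-- permutation of [n] with p exterior peaks gives 2p + 1 permutations with p exterior peaks and
-- n − 2p with p + 1. Attaching a new leaf n + 1 to a vertex x of an increasing tree on [n] with
-- e vertices of even degree keeps e when x has even degree and gives e + 2 otherwise, so e of
-- the n + 1 trees keep e and n + 1 − e get e + 2. For e = 2p + 1 the two recurrences agree, and
-- induction on n gives Σ_trees f(e) = Σ_permutations f(2p + 1) for every weight f; the theorem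
-- is the case where f is the indicator of 2k + 1.

module Submission where

open import Defs
open import Data.Nat using (ℕ; suc; _+_; _*_; _≤_)
open import Relation.Binary.PropositionalEquality using (_≡_)
open import Data.Nat using (zero; _∸_; _<_; z≤n; s≤s; s≤s⁻¹; _≟_; _<ᵇ_)
open import Data.Nat.Properties
open import Algebra.Properties.CommutativeSemigroup +-commutativeSemigroup using (x∙yz≈y∙xz; xy∙z≈zy∙x)
open import Data.Nat.ListAction using (sum)
open import Data.Nat.ListAction.Properties using (sum-++; sum-↭)
open import Data.Bool using (Bool; true; false; if_then_else_; _∧_; not; T)
open import Data.Bool.Properties using (∧-zeroʳ; if-float; T-∧; T?)
open import Data.Unit using (tt)
open import Data.Fin using (Fin; toℕ)
import Data.Fin as F
open import Data.Fin.Properties using (toℕ-injective)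
open import Data.Vec using (Vec; toList)
import Data.Vec as Vec
open import Data.List
  using (List; []; _∷_; _++_; _∷ʳ_; map; concatMap; length; filter; upTo; applyUpTo; tabulate; allFin)
open import Data.List.Properties
  using (map-++; map-∘; map-tabulate; length-++; ∷-injectiveˡ; ∷-injectiveʳ)
open import Data.List.Membership.Propositional using (_∈_; find; lose)
open import Data.List.Membership.DecPropositional _≟_ using (_∈?_)
open import Data.List.Membership.Propositional.Properties
  using (∈-map⁺; ∈-map⁻; ∈-applyUpTo⁺; ∈-applyUpTo⁻; ∈-∃++; ∈-concatMap⁺; ∈-concatMap⁻
        ; ∈-upTo⁺; ∈-upTo⁻; ∈-filter⁺; ∈-filter⁻)
open import Data.List.Membership.Propositional.Properties.WithK using (unique∧set⇒bag)
open import Data.List.Relation.Binary.BagAndSetEquality using (∼bag⇒↭)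
open import Data.List.Relation.Binary.Permutation.Propositional using (_↭_; ↭⇒↭ₛ)
import Data.List.Relation.Binary.Permutation.Setoid.Properties as PermutationSetoid
import Data.List.Relation.Binary.Permutation.Propositional.Properties as ↭
open import Data.List.Relation.Unary.Any using (here; there)
open import Data.List.Relation.Unary.All using (All; []; _∷_)
open import Data.List.Relation.Unary.All.Properties using (¬Any⇒All¬) renaming (++⁺ to All-++⁺)
import Data.List.Relation.Unary.All as All
open import Data.List.Relation.Unary.AllPairs using ([]; _∷_)
open import Data.List.Relation.Unary.Unique.Propositional using (Unique)
import Data.List.Relation.Unary.Unique.Propositional.Properties as Unique
import Data.List.Relation.Unary.Unique.DecPropositional as UniqueDec
open import Data.Product using (∃; _×_; _,_; proj₁; proj₂)
open import Data.Empty using (⊥-elim)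
open import Relation.Nullary using (yes; no; does)
open import Relation.Nullary.Decidable using (dec-true; dec-false; does-⇔)
open import Data.Nat.Divisibility using (_∣?_)
open import Relation.Unary using (Decidable)
import Relation.Binary.PropositionalEquality as ≡
open import Relation.Binary.PropositionalEquality
  using (_≢_; refl; sym; trans; cong; cong₂; subst; module ≡-Reasoning)
open import Function using (_∘_; _⇔_; mk⇔; Equivalence)
open import Level using (Level)

-- Finite sums

private
  variable
    a b c : Level
    A : Set a
    B : Set b
    C : Set c

⟦_⟧ : Bool → ℕ
⟦ b ⟧ = if b then 1 else 0

∑ : (A → ℕ) → List A → ℕ
∑ f xs = sum (map f xs)

∑-cong : ∀ {f g : A → ℕ} xs → (∀ {x} → x ∈ xs → f x ≡ g x) → ∑ f xs ≡ ∑ g xs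
∑-cong []       eq = refl
∑-cong (x ∷ xs) eq = cong₂ _+_ (eq (here refl)) (∑-cong xs (eq ∘ there))

∑-++ : ∀ (f : A → ℕ) xs ys → ∑ f (xs ++ ys) ≡ ∑ f xs + ∑ f ys
∑-++ f xs ys = trans (cong sum (map-++ f xs ys)) (sum-++ (map f xs) (map f ys))

∑-↭ : ∀ (f : A → ℕ) {xs ys} → xs ↭ ys → ∑ f xs ≡ ∑ f ys
∑-↭ f xs↭ys = sum-↭ (↭.map⁺ f xs↭ys)

∑-filter : ∀ {p} {P : A → Set p} (P? : Decidable P) (g : A → ℕ) xs →
           ∑ g (filter P? xs) ≡ ∑ (λ x → ⟦ does (P? x) ⟧ * g x) xs
∑-filter P? g [] = refl
∑-filter P? g (x ∷ xs) with does (P? x)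
... | true  = cong₂ _+_ (sym (+-identityʳ (g x))) (∑-filter P? g xs)
... | false = ∑-filter P? g xs

count≡∑ : ∀ {p} {P : A → Set p} (P? : Decidable P) xs → count P? xs ≡ ∑ (λ x → ⟦ does (P? x) ⟧) xs
count≡∑ P? [] = refl
count≡∑ P? (x ∷ xs) with does (P? x)
... | true  = cong suc (count≡∑ P? xs)
... | false = count≡∑ P? xs

∑-map : ∀ (f : B → ℕ) (g : A → B) xs → ∑ f (map g xs) ≡ ∑ (f ∘ g) xs
∑-map f g xs = cong sum (sym (map-∘ xs))

∑-concatMap : ∀ (f : B → ℕ) (g : A → List B) xs →
              ∑ f (concatMap g xs) ≡ ∑ (λ x → ∑ f (g x)) xs
∑-concatMap f g []       = refl
∑-concatMap f g (x ∷ xs) = trans (∑-++ f (g x) _) (cong (∑ f (g x) +_) (∑-concatMap f g xs))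

∑-concatMap-map : ∀ (g : C → ℕ) (h : A → B → C) (ys : A → List B) xs →
                  ∑ g (concatMap (λ x → map (h x) (ys x)) xs) ≡ ∑ (λ x → ∑ (g ∘ h x) (ys x)) xs
∑-concatMap-map g h ys xs =
  trans (∑-concatMap g _ xs) (∑-cong xs (λ {x} _ → ∑-map g (h x) (ys x)))

∑-zero : ∀ (xs : List A) → ∑ (λ _ → 0) xs ≡ 0
∑-zero []       = refl
∑-zero (_ ∷ xs) = ∑-zero xs

concatMap-unique : ∀ (g : A → List B) xs → Unique xs →
                   (∀ {x} → x ∈ xs → Unique (g x)) →
                   (∀ {x y v} → x ∈ xs → y ∈ xs → v ∈ g x → v ∈ g y → x ≡ y) →
                   Unique (concatMap g xs)
concatMap-unique g []       _          _       _        = []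
concatMap-unique g (x ∷ xs) (x∉ ∷ xs!) g-unique disjoint =
  Unique.++⁺ (g-unique (here refl))
    (concatMap-unique g xs xs! (g-unique ∘ there) (λ p q → disjoint (there p) (there q)))
    λ (v∈gx , v∈rest) → let y , y∈xs , v∈gy = find (∈-concatMap⁻ g v∈rest) in
      All.lookup x∉ y∈xs (disjoint (here refl) (there y∈xs) v∈gx v∈gy)

∑< : ℕ → (ℕ → ℕ) → ℕ
∑< zero    f = 0
∑< (suc n) f = f 0 + ∑< n (f ∘ suc)

∑<-cong : ∀ n {f g : ℕ → ℕ} → (∀ i → i < n → f i ≡ g i) → ∑< n f ≡ ∑< n g
∑<-cong zero    eq = refl
∑<-cong (suc n) eq = cong₂ _+_ (eq 0 (s≤s z≤n)) (∑<-cong n (λ i i<n → eq (suc i) (s≤s i<n)))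

∑<-snoc : ∀ n (f : ℕ → ℕ) → ∑< (suc n) f ≡ ∑< n f + f n
∑<-snoc zero    f = +-comm (f 0) 0
∑<-snoc (suc n) f = trans (cong (f 0 +_) (∑<-snoc n (f ∘ suc))) (sym (+-assoc (f 0) _ _))

∑-applyUpTo : ∀ (f : A → ℕ) (h : ℕ → A) n → ∑ f (applyUpTo h n) ≡ ∑< n (f ∘ h)
∑-applyUpTo f h zero    = refl
∑-applyUpTo f h (suc n) = cong (f (h 0) +_) (∑-applyUpTo f (h ∘ suc) n)

∑<-zero : ∀ N → ∑< N (λ _ → 0) ≡ 0
∑<-zero zero    = refl
∑<-zero (suc N) = ∑<-zero N

∑<-truncate : ∀ N b (h : ℕ → ℕ) → b ≤ N → ∑< N (λ x → ⟦ x <ᵇ b ⟧ * h x) ≡ ∑< b h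
∑<-truncate N       zero    h _         = ∑<-zero N
∑<-truncate (suc N) (suc b) h (s≤s b≤N) = cong₂ _+_ (+-identityʳ (h 0)) (∑<-truncate N b (h ∘ suc) b≤N)

∑<-indicator≤ : ∀ N (b : ℕ → Bool) → ∑< N (⟦_⟧ ∘ b) ≤ N
∑<-indicator≤ zero    b = z≤n
∑<-indicator≤ (suc N) b with b 0
... | true  = s≤s (∑<-indicator≤ N (b ∘ suc))
... | false = m≤n⇒m≤1+n (∑<-indicator≤ N (b ∘ suc))

∑<-if : ∀ N (b : ℕ → Bool) A B →
        ∑< N (λ x → if b x then A else B) ≡ ∑< N (⟦_⟧ ∘ b) * A + (N ∸ ∑< N (⟦_⟧ ∘ b)) * B
∑<-if zero    b A B = refl
∑<-if (suc N) b A B with b 0 | ∑<-if N (b ∘ suc) A B | ∑<-indicator≤ N (b ∘ suc)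
... | true  | ih | _   = trans (cong (A +_) ih) (sym (+-assoc A _ _))
... | false | ih | t≤N =
  trans (cong (B +_) ih) (trans (x∙yz≈y∙xz B (t * A) _) (cong (λ m → t * A + m * B) (sym (+-∸-assoc 1 t≤N))))
  where t = ∑< N (⟦_⟧ ∘ b ∘ suc)

∑<-update : ∀ N (φ ψ : ℕ → ℕ) {x} → x < N → (∀ v → v ≢ x → φ v ≡ ψ v) → ∑< N φ + ψ x ≡ ∑< N ψ + φ x
∑<-update (suc N) φ ψ {zero} _ φ≗ψ
  rewrite ∑<-cong N {φ ∘ suc} {ψ ∘ suc} (λ v _ → φ≗ψ (suc v) λ ()) = xy∙z≈zy∙x (φ 0) _ (ψ 0)
∑<-update (suc N) φ ψ {suc x} (s≤s x<N) φ≗ψ rewrite φ≗ψ 0 (λ ()) =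
  trans (+-assoc (ψ 0) _ _)
    (trans (cong (ψ 0 +_) (∑<-update N (φ ∘ suc) (ψ ∘ suc) x<N (λ v v≢x → φ≗ψ (suc v) (v≢x ∘ suc-injective))))
      (sym (+-assoc (ψ 0) _ _)))

-- Words and insertion

words : List A → ℕ → List (List A)
words xs zero    = [] ∷ []
words xs (suc m) = concatMap (λ x → map (x ∷_) (words xs m)) xs

∈-words⁻ : ∀ (xs : List A) m {w} → w ∈ words xs m → length w ≡ m × All (_∈ xs) w
∈-words⁻ xs zero    (here refl) = refl , []
∈-words⁻ xs (suc m) w∈
  with x , x∈xs , w∈x∷ ← find (∈-concatMap⁻ (λ x → map (x ∷_) (words xs m)) {xs = xs} w∈)
  with v , v∈ , refl ← ∈-map⁻ (x ∷_) w∈x∷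
  = let len , v⊆xs = ∈-words⁻ xs m v∈ in cong suc len , x∈xs ∷ v⊆xs

∈-words⁺ : ∀ (xs : List A) {w} → All (_∈ xs) w → w ∈ words xs (length w)
∈-words⁺ xs []                   = here refl
∈-words⁺ xs {x ∷ w} (x∈xs ∷ w⊆xs) =
  ∈-concatMap⁺ (λ x → map (x ∷_) (words xs (length w))) {xs = xs}
    (lose x∈xs (∈-map⁺ (x ∷_) (∈-words⁺ xs w⊆xs)))

words-unique : ∀ (xs : List A) m → Unique xs → Unique (words xs m)
words-unique xs zero    xs! = [] ∷ []
words-unique xs (suc m) xs! =
  concatMap-unique (λ x → map (x ∷_) (words xs m)) xs xs!
    (λ _ → Unique.map⁺ ∷-injectiveʳ (words-unique xs m xs!)) same-head
  where
  same-head : ∀ {x y v} → x ∈ xs → y ∈ xs → v ∈ map (x ∷_) (words xs m) → v ∈ map (y ∷_) (words xs m) → x ≡ y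
  same-head {x} {y} _ _ p q with _ , _ , refl ← ∈-map⁻ (x ∷_) p | _ , _ , eq ← ∈-map⁻ (y ∷_) q = ∷-injectiveˡ eq

insert : ℕ → A → List A → List A
insert zero    x ys       = x ∷ ys
insert (suc j) x []       = x ∷ []
insert (suc j) x (y ∷ ys) = y ∷ insert j x ys

insertions : A → List A → List (List A)
insertions x ys = applyUpTo (λ j → insert j x ys) (suc (length ys))

length-insert : ∀ j (x : A) ys → length (insert j x ys) ≡ suc (length ys)
length-insert zero    x ys       = refl
length-insert (suc j) x []       = refl
length-insert (suc j) x (y ∷ ys) = cong suc (length-insert j x ys)

All-insert : ∀ {p} {P : A → Set p} j {x ys} → P x → All P ys → All P (insert j x ys)
All-insert zero    px pys         = px ∷ pys
All-insert (suc j) px []          = px ∷ []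
All-insert (suc j) px (py ∷ pys) = py ∷ All-insert j px pys

insert-unique : ∀ j {x : A} {ys} → All (x ≢_) ys → Unique ys → Unique (insert j x ys)
insert-unique zero    x∉ys              ys!          = x∉ys ∷ ys!
insert-unique (suc j) []                []           = [] ∷ []
insert-unique (suc j) (x≢y ∷ x∉ys) (y∉ys ∷ ys!) =
  All-insert j (x≢y ∘ sym) y∉ys ∷ insert-unique j x∉ys ys!

insert-++ : ∀ (xs : List A) x ys → insert (length xs) x (xs ++ ys) ≡ xs ++ x ∷ ys
insert-++ []       x ys = refl
insert-++ (z ∷ xs) x ys = cong (z ∷_) (insert-++ xs x ys)

insert-injective : ∀ j k {x : A} {ys zs} → All (x ≢_) ys → All (x ≢_) zs →
                   j ≤ length ys → k ≤ length zs →
                   insert j x ys ≡ insert k x zs → j ≡ k × ys ≡ zs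
insert-injective zero    zero    _          _          _         _         eq = refl , ∷-injectiveʳ eq
insert-injective zero    (suc k) _          (x≢z ∷ _)  _         (s≤s _)   eq = ⊥-elim (x≢z (∷-injectiveˡ eq))
insert-injective (suc j) zero    (x≢y ∷ _)  _          (s≤s _)   _         eq = ⊥-elim (x≢y (sym (∷-injectiveˡ eq)))
insert-injective (suc j) (suc k) (_ ∷ x∉ys) (_ ∷ x∉zs) (s≤s j≤) (s≤s k≤) eq
  with refl , refl ← insert-injective j k x∉ys x∉zs j≤ k≤ (∷-injectiveʳ eq) = refl , cong (_∷ _) (∷-injectiveˡ eq)

insertions-unique : ∀ {x : A} {ys} → All (x ≢_) ys → Unique (insertions x ys)
insertions-unique x∉ys = Unique.applyUpTo⁺₁ _ _ λ i<j j<1+n eq →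
  let j≤n = s≤s⁻¹ j<1+n in
  <⇒≢ i<j (proj₁ (insert-injective _ _ x∉ys x∉ys (≤-trans (<⇒≤ i<j) j≤n) j≤n eq))

insertions-disjoint : ∀ {x : A} {ys zs w} → All (x ≢_) ys → All (x ≢_) zs →
                      w ∈ insertions x ys → w ∈ insertions x zs → ys ≡ zs
insertions-disjoint {x = x} {ys} {zs} x∉ys x∉zs w∈ w∈′
  with j , j<1+n , refl ← ∈-applyUpTo⁻ (λ j → insert j x ys) w∈
     | k , k<1+n , eq  ← ∈-applyUpTo⁻ (λ k → insert k x zs) w∈′
  = proj₂ (insert-injective j k x∉ys x∉zs (s≤s⁻¹ j<1+n) (s≤s⁻¹ k<1+n) eq)

-- Permutations as words

PermutationWord : ℕ → List ℕ → Set
PermutationWord n σ = length σ ≡ n × All (_< n) σ × Unique σ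

permutationWords : ℕ → List (List ℕ)
permutationWords n = filter (UniqueDec.unique? _≟_) (words (upTo n) n)

∈-permutationWords⁻ : ∀ n {σ} → σ ∈ permutationWords n → PermutationWord n σ
∈-permutationWords⁻ n σ∈
  with σ∈words , σ! ← ∈-filter⁻ (UniqueDec.unique? _≟_) σ∈
  with len , σ⊆ ← ∈-words⁻ (upTo n) n σ∈words
  = len , All.map ∈-upTo⁻ σ⊆ , σ!

∈-permutationWords⁺ : ∀ n {σ} → PermutationWord n σ → σ ∈ permutationWords n
∈-permutationWords⁺ n (refl , σ<n , σ!) =
  ∈-filter⁺ (UniqueDec.unique? _≟_) (∈-words⁺ (upTo n) (All.map ∈-upTo⁺ σ<n)) σ!

permutationWords-unique : ∀ n → Unique (permutationWords n)
permutationWords-unique n = Unique.filter⁺ (UniqueDec.unique? _≟_) (words-unique (upTo n) n (Unique.upTo⁺ n))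

bound∉ : ∀ {n σ} → All (_< n) σ → All (n ≢_) σ
bound∉ = All.map >⇒≢

below-if-absent : ∀ {m w} → All (m ≢_) w → All (_< suc m) w → All (_< m) w
below-if-absent []            []            = []
below-if-absent (m≢y ∷ m∉w) (y≤m ∷ w≤m) = ≤∧≢⇒< (s≤s⁻¹ y≤m) (m≢y ∘ sym) ∷ below-if-absent m∉w w≤m

Unique-resp-↭ : ∀ {xs ys : List A} → xs ↭ ys → Unique xs → Unique ys
Unique-resp-↭ xs↭ys = PermutationSetoid.Unique-resp-↭ (≡.setoid _) (↭⇒↭ₛ xs↭ys)

unique-bounded⇒length≤ : ∀ m {w} → Unique w → All (_< m) w → length w ≤ m
unique-bounded⇒length≤ zero    {[]}    _ _         = z≤n
unique-bounded⇒length≤ zero    {_ ∷ _} _ (() ∷ _)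
unique-bounded⇒length≤ (suc m) {w} w! w<1+m with m ∈? w
... | no m∉w = m≤n⇒m≤1+n (unique-bounded⇒length≤ m w! (below-if-absent (¬Any⇒All¬ w m∉w) w<1+m))
... | yes m∈w
  with a , c , refl ← ∈-∃++ m∈w
  with m∉ac ∷ ac! ← Unique-resp-↭ (↭.shift m a c) w!
  with _ ∷ ac<1+m ← ↭.All-resp-↭ (↭.shift m a c) w<1+m
  = subst (_≤ suc m) (sym (↭.↭-length (↭.shift m a c)))
      (s≤s (unique-bounded⇒length≤ m ac! (below-if-absent m∉ac ac<1+m)))

PermutationWord-insert : ∀ {n σ} j → PermutationWord n σ → PermutationWord (suc n) (insert j n σ)
PermutationWord-insert {n} {σ} j (len , σ<n , σ!) =
  trans (length-insert j n σ) (cong suc len) ,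
  All-insert j ≤-refl (All.map m≤n⇒m≤1+n σ<n) ,
  insert-unique j (bound∉ σ<n) σ!

PermutationWord-suc⇒insertion : ∀ {n v} → PermutationWord (suc n) v →
                                ∃ λ σ → PermutationWord n σ × v ∈ insertions n σ
PermutationWord-suc⇒insertion {n} {v} (len , v<1+n , v!) with n ∈? v
... | no n∉v = ⊥-elim (1+n≰n (subst (_≤ n) len
        (unique-bounded⇒length≤ n v! (below-if-absent (¬Any⇒All¬ v n∉v) v<1+n))))
... | yes n∈v
  with a , c , refl ← ∈-∃++ n∈v
  with n∉ac ∷ ac! ← Unique-resp-↭ (↭.shift n a c) v!
  with _ ∷ ac<1+n ← ↭.All-resp-↭ (↭.shift n a c) v<1+n
  = a ++ c ,
    (suc-injective (trans (sym (↭.↭-length (↭.shift n a c))) len) , below-if-absent n∉ac ac<1+n , ac!) ,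
    subst (_∈ insertions n (a ++ c)) (insert-++ a n c)
      (∈-applyUpTo⁺ (λ j → insert j n (a ++ c)) (s≤s (subst (length a ≤_) (sym (length-++ a)) (m≤m+n _ _))))

permutationWords-suc : ∀ n → permutationWords (suc n) ↭ concatMap (insertions n) (permutationWords n)
permutationWords-suc n =
  ∼bag⇒↭ (unique∧set⇒bag (permutationWords-unique (suc n)) insertions! (mk⇔ to from))
  where
  n∉ : ∀ {σ} → σ ∈ permutationWords n → All (n ≢_) σ
  n∉ σ∈ = bound∉ (proj₁ (proj₂ (∈-permutationWords⁻ n σ∈)))

  insertions! : Unique (concatMap (insertions n) (permutationWords n))
  insertions! = concatMap-unique (insertions n) _ (permutationWords-unique n)
    (insertions-unique ∘ n∉) (λ σ∈ σ′∈ → insertions-disjoint (n∉ σ∈) (n∉ σ′∈))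

  to : ∀ {v} → v ∈ permutationWords (suc n) → v ∈ concatMap (insertions n) (permutationWords n)
  to v∈ with σ , σ-perm , v∈ins ← PermutationWord-suc⇒insertion (∈-permutationWords⁻ (suc n) v∈) =
    ∈-concatMap⁺ (insertions n) (lose (∈-permutationWords⁺ n σ-perm) v∈ins)

  from : ∀ {v} → v ∈ concatMap (insertions n) (permutationWords n) → v ∈ permutationWords (suc n)
  from v∈
    with σ , σ∈ , v∈ins ← find (∈-concatMap⁻ (insertions n) {xs = permutationWords n} v∈)
    with j , _ , refl ← ∈-applyUpTo⁻ (λ j → insert j n σ) v∈ins
    = ∈-permutationWords⁺ (suc n) (PermutationWord-insert j (∈-permutationWords⁻ n σ∈))

-- Exterior peaks under insertion of the maximum

<ᵇ-true : ∀ {m n} → m < n → (m <ᵇ n) ≡ true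
<ᵇ-true {zero}  {suc n} _         = refl
<ᵇ-true {suc m} {suc n} (s≤s m<n) = <ᵇ-true m<n

<ᵇ-false : ∀ {m n} → n ≤ m → (m <ᵇ n) ≡ false
<ᵇ-false {m}     {zero}  _         = refl
<ᵇ-false {suc m} {suc n} (s≤s n≤m) = <ᵇ-false n≤m

<ᵇ-asym : ∀ m n → (m <ᵇ n) ≡ true → (n <ᵇ m) ≡ false
<ᵇ-asym zero    (suc n) _  = refl
<ᵇ-asym (suc m) (suc n) eq = <ᵇ-asym m n eq

-- `up` records whether the letter preceding the word is smaller than its head;
-- `peaksFrom true` treats that letter as -∞, which gives the exterior peaks.
peaksFrom : Bool → List ℕ → ℕ
peaksFrom up (y ∷ z ∷ r) = ⟦ up ∧ (z <ᵇ y) ⟧ + peaksFrom (y <ᵇ z) (z ∷ r)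
peaksFrom up _           = 0

headPeak : Bool → List ℕ → Bool
headPeak up (y ∷ z ∷ r) = up ∧ (z <ᵇ y)
headPeak up _           = false

peaksFrom-headPeak : ∀ up y r → peaksFrom up (y ∷ r) ≡ ⟦ headPeak up (y ∷ r) ⟧ + peaksFrom false (y ∷ r)
peaksFrom-headPeak up y []      = refl
peaksFrom-headPeak up y (z ∷ r) = refl

interiorPeaks≡peaksFrom : ∀ a b r → interiorPeaks (a ∷ b ∷ r) ≡ peaksFrom (a <ᵇ b) (b ∷ r)
interiorPeaks≡peaksFrom a b []      = refl
interiorPeaks≡peaksFrom a b (c ∷ r) = cong (⟦ (a <ᵇ b) ∧ (c <ᵇ b) ⟧ +_) (interiorPeaks≡peaksFrom b c r)

exteriorPeaksList≡peaksFrom : ∀ w → exteriorPeaksList w ≡ peaksFrom true w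
exteriorPeaksList≡peaksFrom []          = refl
exteriorPeaksList≡peaksFrom (a ∷ [])    = refl
exteriorPeaksList≡peaksFrom (a ∷ b ∷ r) = cong (⟦ b <ᵇ a ⟧ +_) (interiorPeaks≡peaksFrom a b r)

-- A new maximum inserted into a gap becomes a peak unless the gap is the last one, and it
-- destroys the peak beside the gap if there is one. So among n gaps of a word with p peaks,
-- keep = 2p + 1 − h leave the peak count at p and gain raise it to p + 1, where h = 1 when
-- the head is a peak whose left gap is not among the n.
record PeakSplit (f : ℕ → ℕ) (p h n S : ℕ) : Set where
  field
    keep gain : ℕ
    sum≡      : S ≡ keep * f p + gain * f (suc p)
    keep+h≡   : keep + h ≡ suc (p + p)
    count≡    : keep + gain ≡ n

module _ {f : ℕ → ℕ} where

  split-single : ∀ {t} → t ≡ 0 → PeakSplit f 0 0 1 (f t + 0)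
  split-single refl = record
    { keep = 1 ; gain = 0 ; sum≡ = sym (+-identityʳ (f 0 + 0)) ; keep+h≡ = refl ; count≡ = refl }

  split-gain : ∀ {p h n S} → PeakSplit f p h n S → PeakSplit f p h (suc n) (f (suc p) + S)
  split-gain {p} s = record
    { keep = keep ; gain = suc gain ; keep+h≡ = keep+h≡
    ; sum≡ = trans (cong (f (suc p) +_) sum≡) (x∙yz≈y∙xz (f (suc p)) (keep * f p) (gain * f (suc p)))
    ; count≡ = trans (+-suc keep gain) (cong suc count≡) }
    where open PeakSplit s

  split-keep : ∀ {p h n S} → PeakSplit f p (suc h) n S → PeakSplit f p h (suc n) (f p + S)
  split-keep {p} {h} s = record
    { keep = suc keep ; gain = gain
    ; sum≡ = trans (cong (f p +_) sum≡) (sym (+-assoc (f p) (keep * f p) _))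
    ; keep+h≡ = trans (sym (+-suc keep h)) keep+h≡
    ; count≡ = cong suc count≡ }
    where open PeakSplit s

  split-shift : ∀ {p n S} → PeakSplit (f ∘ suc) p 0 n S → PeakSplit f (suc p) 1 (suc n) (f (suc p) + S)
  split-shift {p} s = record
    { keep = suc keep ; gain = gain
    ; sum≡ = trans (cong (f (suc p) +_) sum≡) (sym (+-assoc (f (suc p)) (keep * f (suc p)) _))
    ; keep+h≡ = trans (+-comm (suc keep) 1) (cong (suc ∘ suc) (trans (sym (+-identityʳ keep))
                  (trans keep+h≡ (sym (+-suc p p)))))
    ; count≡ = cong suc count≡ }
    where open PeakSplit s

-- Splits the positions after the head y of y ∷ z ∷ r into the one right after y and those
-- after z: c and h say whether y and z are peaks (never both), q counts the other peaks, and
-- inserting right after y leaves q + 1 peaks.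
split-step : ∀ {f} (c h : Bool) {t q p n S} → t ≡ suc q → p ≡ ⟦ h ⟧ + q → (c ≡ true → h ≡ false) →
             PeakSplit (λ t → f (⟦ c ⟧ + t)) p ⟦ h ⟧ n S →
             PeakSplit f (⟦ c ⟧ + p) ⟦ c ⟧ (suc n) (f t + S)
split-step false false refl refl _ s = split-gain s
split-step false true  refl refl _ s = split-keep s
split-step true  false refl refl _ s = split-shift s
split-step true  true  refl refl c⇒¬h _ with () ← c⇒¬h refl

headPeak-after-descent : ∀ up {y z} r → up ∧ (z <ᵇ y) ≡ true → headPeak (y <ᵇ z) (z ∷ r) ≡ false
headPeak-after-descent true {y} {z} r z<y rewrite <ᵇ-asym z y z<y with r
... | []    = refl
... | _ ∷ _ = refl

peaksFrom-max-head : ∀ {M} y r → y < M → peaksFrom true (M ∷ y ∷ r) ≡ suc (peaksFrom false (y ∷ r))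
peaksFrom-max-head {M} y r y<M rewrite <ᵇ-true y<M | <ᵇ-false {M} {y} (<⇒≤ y<M) = refl

peaksFrom-before-max : ∀ up {M} y w → y < M → peaksFrom up (y ∷ M ∷ w) ≡ peaksFrom true (M ∷ w)
peaksFrom-before-max up {M} y w y<M rewrite <ᵇ-false {M} {y} (<⇒≤ y<M) | ∧-zeroʳ up | <ᵇ-true y<M = refl

peaksFrom-insert : ∀ {M} up y r → All (_< M) (y ∷ r) → (f : ℕ → ℕ) →
  PeakSplit f (peaksFrom up (y ∷ r)) ⟦ headPeak up (y ∷ r) ⟧ (suc (length r))
    (∑< (suc (length r)) (λ j → f (peaksFrom up (y ∷ insert j M r))))
peaksFrom-insert up y [] (y<M ∷ []) f = split-single (peaksFrom-before-max up y [] y<M)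
peaksFrom-insert up y (z ∷ r) (y<M ∷ z<M ∷ r<M) f =
  split-step (up ∧ (z <ᵇ y)) (headPeak (y <ᵇ z) (z ∷ r))
    (trans (peaksFrom-before-max up y (z ∷ r) y<M) (peaksFrom-max-head z r z<M))
    (peaksFrom-headPeak (y <ᵇ z) z r) (headPeak-after-descent up r)
    (peaksFrom-insert (y <ᵇ z) z r (z<M ∷ r<M) (λ t → f (⟦ up ∧ (z <ᵇ y) ⟧ + t)))

exteriorPeaks-insert : ∀ {M} σ → All (_< M) σ → (f : ℕ → ℕ) →
  PeakSplit f (peaksFrom true σ) 0 (suc (length σ))
    (∑< (suc (length σ)) (λ j → f (peaksFrom true (insert j M σ))))
exteriorPeaks-insert []      []           f = split-single refl
exteriorPeaks-insert (y ∷ r) (y<M ∷ r<M) f =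
  split-step false (headPeak true (y ∷ r)) (peaksFrom-max-head y r y<M)
    (peaksFrom-headPeak true y r) (λ ()) (peaksFrom-insert true y r (y<M ∷ r<M) f)

peakStep : ℕ → (ℕ → ℕ) → ℕ → ℕ
peakStep n f p = suc (p + p) * f p + (n ∸ (p + p)) * f (suc p)

PeakSplit⇒≡ : ∀ {f p n S} → PeakSplit f p 0 (suc n) S → S ≡ peakStep n f p
PeakSplit⇒≡ {f} {p} s = trans sum≡ (cong₂ (λ k g → k * f p + g * f (suc p)) keep≡ gain≡)
  where
  open PeakSplit s
  keep≡ : keep ≡ suc (p + p)
  keep≡ = trans (sym (+-identityʳ keep)) keep+h≡
  gain≡ : gain ≡ _
  gain≡ = trans (sym (m+n∸m≡n keep gain)) (cong₂ _∸_ count≡ keep≡)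

∑-peaks-suc : ∀ n (f : ℕ → ℕ) →
  ∑ (f ∘ peaksFrom true) (permutationWords (suc n)) ≡ ∑ (peakStep n f ∘ peaksFrom true) (permutationWords n)
∑-peaks-suc n f = begin
  ∑ g (permutationWords (suc n))                       ≡⟨ ∑-↭ g (permutationWords-suc n) ⟩
  ∑ g (concatMap (insertions n) (permutationWords n))  ≡⟨ ∑-concatMap g (insertions n) (permutationWords n) ⟩
  ∑ (λ σ → ∑ g (insertions n σ)) (permutationWords n)  ≡⟨ ∑-cong (permutationWords n) insertion-sum ⟩
  ∑ (peakStep n f ∘ peaksFrom true) (permutationWords n) ∎
  where
  open ≡-Reasoning
  g : List ℕ → ℕ
  g = f ∘ peaksFrom true
  insertion-sum : ∀ {σ} → σ ∈ permutationWords n → ∑ g (insertions n σ) ≡ peakStep n f (peaksFrom true σ)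
  insertion-sum {σ} σ∈ with len , σ<n , _ ← ∈-permutationWords⁻ n σ∈ =
    trans (∑-applyUpTo g (λ j → insert j n σ) (suc (length σ)))
      (trans (PeakSplit⇒≡ (exteriorPeaks-insert σ σ<n f))
        (cong (λ m → peakStep m f (peaksFrom true σ)) len))

-- Increasing trees as parent words

-- Words whose k-th letter (from 0) is below b + k. For b = 1 these are the parent maps of the
-- increasing trees on [n], letter k being the parent of vertex k + 1.
parentWords : ℕ → ℕ → List (List ℕ)
parentWords b zero    = [] ∷ []
parentWords b (suc m) = concatMap (λ x → map (x ∷_) (parentWords (suc b) m)) (upTo b)

∑-parentWords-suc : ∀ b m (g : List ℕ → ℕ) →
  ∑ g (parentWords b (suc m)) ≡ ∑< b (λ x → ∑ (g ∘ (x ∷_)) (parentWords (suc b) m))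
∑-parentWords-suc b m g =
  trans (∑-concatMap-map g _∷_ (λ _ → parentWords (suc b) m) (upTo b))
    (∑-applyUpTo (λ x → ∑ (g ∘ (x ∷_)) (parentWords (suc b) m)) (λ x → x) b)

∑-parentWords-∷ʳ : ∀ b m (g : List ℕ → ℕ) →
  ∑ g (parentWords b (suc m)) ≡ ∑ (λ w → ∑< (b + m) (λ x → g (w ∷ʳ x))) (parentWords b m)
∑-parentWords-∷ʳ b zero g = begin
  ∑ g (parentWords b 1)         ≡⟨ ∑-parentWords-suc b 0 g ⟩
  ∑< b (λ x → g (x ∷ []) + 0)   ≡⟨ ∑<-cong b (λ x _ → +-identityʳ (g (x ∷ []))) ⟩
  ∑< b (λ x → g (x ∷ []))       ≡⟨ cong (λ c → ∑< c (λ x → g (x ∷ []))) (sym (+-identityʳ b)) ⟩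
  ∑< (b + 0) (λ x → g (x ∷ [])) ≡⟨ sym (+-identityʳ _) ⟩
  ∑ (λ w → ∑< (b + 0) (λ x → g (w ∷ʳ x))) (parentWords b 0) ∎
  where open ≡-Reasoning
∑-parentWords-∷ʳ b (suc m) g = begin
  ∑ g (parentWords b (suc (suc m)))
    ≡⟨ ∑-parentWords-suc b (suc m) g ⟩
  ∑< b (λ x → ∑ (g ∘ (x ∷_)) (parentWords (suc b) (suc m)))
    ≡⟨ ∑<-cong b (λ x _ → ∑-parentWords-∷ʳ (suc b) m (g ∘ (x ∷_))) ⟩
  ∑< b (λ x → ∑ (λ v → ∑< (suc b + m) (λ y → g (x ∷ v ∷ʳ y))) (parentWords (suc b) m))
    ≡⟨ cong (λ c → ∑< b (λ x → ∑ (λ v → ∑< c (λ y → g (x ∷ v ∷ʳ y))) (parentWords (suc b) m)))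
         (sym (+-suc b m)) ⟩
  ∑< b (λ x → ∑ (λ v → ∑< (b + suc m) (λ y → g (x ∷ v ∷ʳ y))) (parentWords (suc b) m))
    ≡⟨ sym (∑-parentWords-suc b m (λ w → ∑< (b + suc m) (λ y → g (w ∷ʳ y)))) ⟩
  ∑ (λ w → ∑< (b + suc m) (λ y → g (w ∷ʳ y))) (parentWords b (suc m)) ∎
  where open ≡-Reasoning

parentWords-bounded : ∀ b m {w} → w ∈ parentWords b m → All (_< b + m) w
parentWords-bounded b zero    (here refl) = []
parentWords-bounded b (suc m) w∈
  with x , x∈ , w∈x∷ ← find (∈-concatMap⁻ (λ x → map (x ∷_) (parentWords (suc b) m)) {xs = upTo b} w∈)
  with v , v∈ , refl ← ∈-map⁻ (x ∷_) w∈x∷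
  rewrite +-suc b m
  = ≤-trans (∈-upTo⁻ x∈) (m≤n⇒m≤1+n (m≤m+n b m)) ∷ parentWords-bounded (suc b) m v∈

even : ℕ → Bool
even n = does (2 ∣? n)

even-suc : ∀ n → even (suc n) ≡ not (even n)
even-suc zero          = refl
even-suc (suc zero)    = refl
even-suc (suc (suc n)) = even-suc n

occurrences : ℕ → List ℕ → ℕ
occurrences v = ∑ (λ x → ⟦ does (x ≟ v) ⟧)

occurrences-∷ʳ : ∀ v w x → occurrences v (w ∷ʳ x) ≡ occurrences v w + ⟦ does (x ≟ v) ⟧
occurrences-∷ʳ v w x = trans (∑-++ _ w (x ∷ [])) (cong (occurrences v w +_) (+-identityʳ _))

occurrences-above : ∀ {v w} → All (_< v) w → occurrences v w ≡ 0
occurrences-above []                = refl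
occurrences-above {v} (x<v ∷ w<v) rewrite dec-false (_ ≟ v) (<⇒≢ x<v) = occurrences-above w<v

-- For the parent word w of a tree, occurrences v w is the degree of vertex v.
evenCount : ℕ → List ℕ → ℕ
evenCount n w = ∑< (suc n) (λ v → ⟦ even (occurrences v w) ⟧)

parity-step : ∀ S E (e : Bool) → S + ⟦ e ⟧ ≡ E + ⟦ not e ⟧ → S + 1 ≡ (if e then E else 2 + E)
parity-step S E true  eq = trans eq (+-identityʳ E)
parity-step S E false eq =
  trans (+-comm S 1) (cong suc (trans (sym (+-identityʳ S)) (trans eq (+-comm E 1))))

evenCount-∷ʳ : ∀ n w x → All (_< suc n) w → x < suc n →
  evenCount (suc n) (w ∷ʳ x) ≡ (if even (occurrences x w) then evenCount n w else 2 + evenCount n w)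
evenCount-∷ʳ n w x w<1+n x<1+n = begin
  evenCount (suc n) (w ∷ʳ x)                ≡⟨ ∑<-snoc (suc n) φ ⟩
  ∑< (suc n) φ + ⟦ even (occurrences (suc n) (w ∷ʳ x)) ⟧
    ≡⟨ cong (λ o → ∑< (suc n) φ + ⟦ even o ⟧) (occurrences-above (All-++⁺ w<1+n (x<1+n ∷ []))) ⟩
  ∑< (suc n) φ + 1
    ≡⟨ parity-step _ _ (even (occurrences x w))
         (trans (∑<-update (suc n) φ ψ x<1+n φ≗ψ) (cong (evenCount n w +_) φx)) ⟩
  (if even (occurrences x w) then evenCount n w else 2 + evenCount n w) ∎
  where
  open ≡-Reasoning
  φ ψ : ℕ → ℕ
  φ v = ⟦ even (occurrences v (w ∷ʳ x)) ⟧
  ψ v = ⟦ even (occurrences v w) ⟧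
  φ≗ψ : ∀ v → v ≢ x → φ v ≡ ψ v
  φ≗ψ v v≢x rewrite occurrences-∷ʳ v w x | dec-false (x ≟ v) (v≢x ∘ sym) | +-identityʳ (occurrences v w) =
    refl
  φx : φ x ≡ ⟦ not (even (occurrences x w)) ⟧
  φx rewrite occurrences-∷ʳ x w x | dec-true (x ≟ x) refl | +-comm (occurrences x w) 1 =
    cong ⟦_⟧ (even-suc (occurrences x w))

evenStep : ℕ → (ℕ → ℕ) → ℕ → ℕ
evenStep n f e = e * f e + (suc n ∸ e) * f (2 + e)

∑-evenCount-suc : ∀ n (f : ℕ → ℕ) →
  ∑ (f ∘ evenCount (suc n)) (parentWords 1 (suc n)) ≡ ∑ (evenStep n f ∘ evenCount n) (parentWords 1 n)
∑-evenCount-suc n f =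
  trans (∑-parentWords-∷ʳ 1 n (f ∘ evenCount (suc n))) (∑-cong (parentWords 1 n) leaf-sum)
  where
  leaf-sum : ∀ {w} → w ∈ parentWords 1 n →
             ∑< (suc n) (λ x → f (evenCount (suc n) (w ∷ʳ x))) ≡ evenStep n f (evenCount n w)
  leaf-sum {w} w∈ =
    trans (∑<-cong (suc n) (λ x x<1+n → trans (cong f (evenCount-∷ʳ n w x (parentWords-bounded 1 n w∈) x<1+n))
                                                 (if-float f (even (occurrences x w)))))
          (∑<-if (suc n) (λ x → even (occurrences x w)) _ _)

-- Equidistribution

odd : ℕ → ℕ
odd p = suc (p + p)

evenStep-odd : ∀ n f p → evenStep n f (odd p) ≡ peakStep n (f ∘ odd) p
evenStep-odd n f p =
  cong (λ t → suc (p + p) * f (suc (p + p)) + (n ∸ (p + p)) * f (suc (suc t))) (sym (+-suc p p))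

∑-evenCount≡∑-peaks : ∀ n (f : ℕ → ℕ) →
  ∑ (f ∘ evenCount n) (parentWords 1 n) ≡ ∑ (f ∘ odd ∘ peaksFrom true) (permutationWords n)
∑-evenCount≡∑-peaks zero    f = refl
∑-evenCount≡∑-peaks (suc n) f = begin
  ∑ (f ∘ evenCount (suc n)) (parentWords 1 (suc n))    ≡⟨ ∑-evenCount-suc n f ⟩
  ∑ (evenStep n f ∘ evenCount n) (parentWords 1 n)     ≡⟨ ∑-evenCount≡∑-peaks n (evenStep n f) ⟩
  ∑ (evenStep n f ∘ odd ∘ peaksFrom true) (permutationWords n)
    ≡⟨ ∑-cong (permutationWords n) (λ {σ} _ → evenStep-odd n f (peaksFrom true σ)) ⟩
  ∑ (peakStep n (f ∘ odd) ∘ peaksFrom true) (permutationWords n) ≡⟨ ∑-peaks-suc n (f ∘ odd) ⟨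
  ∑ (f ∘ odd ∘ peaksFrom true) (permutationWords (suc n)) ∎
  where open ≡-Reasoning

-- Translation from the vector encodings

toWord : ∀ {K m} → Vec (Fin K) m → List ℕ
toWord π = map toℕ (toList π)

∑-allVecs : ∀ (f : A → B) (g : List B → ℕ) xs m →
            ∑ (g ∘ map f ∘ toList) (allVecs xs m) ≡ ∑ g (words (map f xs) m)
∑-allVecs f g xs zero    = refl
∑-allVecs f g xs (suc m) = begin
  ∑ (g ∘ map f ∘ toList) (allVecs xs (suc m))
    ≡⟨ ∑-concatMap-map (g ∘ map f ∘ toList) Vec._∷_ (λ _ → allVecs xs m) xs ⟩
  ∑ (λ x → ∑ (g ∘ (f x ∷_) ∘ map f ∘ toList) (allVecs xs m)) xs
    ≡⟨ ∑-cong xs (λ {x} _ → ∑-allVecs f (g ∘ (f x ∷_)) xs m) ⟩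
  ∑ (λ x → ∑ (g ∘ (f x ∷_)) (words (map f xs) m)) xs
    ≡⟨ ∑-map (λ y → ∑ (g ∘ (y ∷_)) (words (map f xs) m)) f xs ⟨
  ∑ (λ y → ∑ (g ∘ (y ∷_)) (words (map f xs) m)) (map f xs)
    ≡⟨ ∑-concatMap-map g _∷_ (λ _ → words (map f xs) m) (map f xs) ⟨
  ∑ g (words (map f xs) (suc m)) ∎
  where open ≡-Reasoning

tabulate-toℕ : ∀ N (h : ℕ → A) → tabulate {n = N} (h ∘ toℕ) ≡ applyUpTo h N
tabulate-toℕ zero    h = refl
tabulate-toℕ (suc N) h = cong (h 0 ∷_) (tabulate-toℕ N (h ∘ suc))

map-toℕ-allFin : ∀ N → map toℕ (allFin N) ≡ upTo N
map-toℕ-allFin N = trans (map-tabulate (λ i → i) toℕ) (tabulate-toℕ N (λ i → i))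

∑-allFin-toℕ : ∀ N (h : ℕ → ℕ) → ∑ (h ∘ toℕ) (allFin N) ≡ ∑< N h
∑-allFin-toℕ N h =
  trans (sym (∑-map h toℕ (allFin N))) (trans (cong (∑ h) (map-toℕ-allFin N)) (∑-applyUpTo h (λ i → i) N))

tabulate-lookup-toList : ∀ {m} (p : Vec A m) → tabulate (Vec.lookup p) ≡ toList p
tabulate-lookup-toList Vec.[]      = refl
tabulate-lookup-toList (x Vec.∷ p) = cong (x ∷_) (tabulate-lookup-toList p)

∑-allFin-lookup : ∀ {m} (g : A → ℕ) (p : Vec A m) → ∑ (g ∘ Vec.lookup p) (allFin m) ≡ ∑ g (toList p)
∑-allFin-lookup {m = m} g p =
  trans (sym (∑-map g (Vec.lookup p) (allFin m)))
    (cong (∑ g) (trans (map-tabulate (λ i → i) (Vec.lookup p)) (tabulate-lookup-toList p)))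

∑-permutations : ∀ n (f : ℕ → ℕ) →
  ∑ (f ∘ exteriorPeaks) (filter isPerm? (allVecs (allFin n) n)) ≡ ∑ (f ∘ peaksFrom true) (permutationWords n)
∑-permutations n f = begin
  ∑ (f ∘ exteriorPeaks) (filter isPerm? vecs)
    ≡⟨ ∑-filter isPerm? (f ∘ exteriorPeaks) vecs ⟩
  ∑ (λ π → ⟦ does (isPerm? π) ⟧ * f (exteriorPeaks π)) vecs
    ≡⟨ ∑-cong vecs (λ {π} _ → cong₂ (λ b e → ⟦ b ⟧ * f e)
         (does-⇔ (mk⇔ (Unique.map⁺ toℕ-injective) Unique.map⁻) (isPerm? π) (unique? (toWord π)))
         (exteriorPeaksList≡peaksFrom (toWord π))) ⟩
  ∑ (g ∘ map toℕ ∘ toList) vecs      ≡⟨ ∑-allVecs toℕ g (allFin n) n ⟩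
  ∑ g (words (map toℕ (allFin n)) n) ≡⟨ cong (λ xs → ∑ g (words xs n)) (map-toℕ-allFin n) ⟩
  ∑ g (words (upTo n) n)             ≡⟨ ∑-filter unique? (f ∘ peaksFrom true) (words (upTo n) n) ⟨
  ∑ (f ∘ peaksFrom true) (permutationWords n) ∎
  where
  open ≡-Reasoning
  vecs = allVecs (allFin n) n
  unique? = UniqueDec.unique? _≟_
  g : List ℕ → ℕ
  g w = ⟦ does (unique? w) ⟧ * f (peaksFrom true w)

isParentWord : ℕ → List ℕ → Bool
isParentWord b []      = true
isParentWord b (x ∷ w) = (x <ᵇ b) ∧ isParentWord (suc b) w

isParentWord-lookup : ∀ {K m} (p : Vec (Fin K) m) b →
  (∀ i → toℕ (Vec.lookup p i) < b + toℕ i) ⇔ T (isParentWord b (toWord p))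
isParentWord-lookup Vec.[]      b = mk⇔ (λ _ → tt) (λ _ ())
isParentWord-lookup (x Vec.∷ p) b = mk⇔ to from
  where
  rest = isParentWord-lookup p (suc b)
  to : (∀ i → toℕ (Vec.lookup (x Vec.∷ p) i) < b + toℕ i) → T (isParentWord b (toWord (x Vec.∷ p)))
  to h = Equivalence.from T-∧
    ( <⇒<ᵇ (subst (toℕ x <_) (+-identityʳ b) (h F.zero))
    , Equivalence.to rest (λ i → subst (toℕ (Vec.lookup p i) <_) (+-suc b (toℕ i)) (h (F.suc i))) )
  from : T (isParentWord b (toWord (x Vec.∷ p))) → ∀ i → toℕ (Vec.lookup (x Vec.∷ p) i) < b + toℕ i
  from t F.zero    = subst (toℕ x <_) (sym (+-identityʳ b)) (<ᵇ⇒< _ _ (proj₁ (Equivalence.to T-∧ t)))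
  from t (F.suc i) = subst (toℕ (Vec.lookup p i) <_) (sym (+-suc b (toℕ i)))
                       (Equivalence.from rest (proj₂ (Equivalence.to T-∧ t)) i)

∑-isParentWord : ∀ N b m (g : List ℕ → ℕ) → b + m ≤ N →
  ∑ (λ w → ⟦ isParentWord b w ⟧ * g w) (words (upTo N) m) ≡ ∑ g (parentWords b m)
∑-isParentWord N b zero    g _   = cong (_+ 0) (+-identityʳ (g []))
∑-isParentWord N b (suc m) g b+m≤N = begin
  ∑ (λ w → ⟦ isParentWord b w ⟧ * g w) (words (upTo N) (suc m))
    ≡⟨ ∑-concatMap-map _ _∷_ (λ _ → words (upTo N) m) (upTo N) ⟩
  ∑ (λ x → ∑ (λ w → ⟦ isParentWord b (x ∷ w) ⟧ * g (x ∷ w)) (words (upTo N) m)) (upTo N)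
    ≡⟨ ∑-applyUpTo _ (λ x → x) N ⟩
  ∑< N (λ x → ∑ (λ w → ⟦ isParentWord b (x ∷ w) ⟧ * g (x ∷ w)) (words (upTo N) m))
    ≡⟨ ∑<-cong N (λ x _ → first-letter x) ⟩
  ∑< N (λ x → ⟦ x <ᵇ b ⟧ * ∑ (g ∘ (x ∷_)) (parentWords (suc b) m))
    ≡⟨ ∑<-truncate N b _ (≤-trans (m≤m+n b (suc m)) b+m≤N) ⟩
  ∑< b (λ x → ∑ (g ∘ (x ∷_)) (parentWords (suc b) m))
    ≡⟨ ∑-parentWords-suc b m g ⟨
  ∑ g (parentWords b (suc m)) ∎
  where
  open ≡-Reasoning
  first-letter : ∀ x → ∑ (λ w → ⟦ isParentWord b (x ∷ w) ⟧ * g (x ∷ w)) (words (upTo N) m)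
                       ≡ ⟦ x <ᵇ b ⟧ * ∑ (g ∘ (x ∷_)) (parentWords (suc b) m)
  first-letter x with x <ᵇ b
  ... | true  = trans (∑-isParentWord N (suc b) m (g ∘ (x ∷_)) (subst (_≤ N) (+-suc b m) b+m≤N))
                      (sym (+-identityʳ _))
  ... | false = ∑-zero (words (upTo N) m)

degree≡occurrences : ∀ {n} (p : Vec (Fin (suc n)) n) v → degree p v ≡ occurrences (toℕ v) (toWord p)
degree≡occurrences {n} p v = begin
  degree p v                                             ≡⟨ count≡∑ (λ i → Vec.lookup p i F.≟ v) (allFin n) ⟩
  ∑ ((λ y → ⟦ does (y F.≟ v) ⟧) ∘ Vec.lookup p) (allFin n) ≡⟨ ∑-allFin-lookup (λ y → ⟦ does (y F.≟ v) ⟧) p ⟩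
  ∑ (λ y → ⟦ does (y F.≟ v) ⟧) (toList p)
    ≡⟨ ∑-cong (toList p) (λ {y} _ → cong ⟦_⟧ (does-⇔ (mk⇔ (cong toℕ) toℕ-injective) (y F.≟ v) (toℕ y ≟ toℕ v))) ⟩
  ∑ (λ y → ⟦ does (toℕ y ≟ toℕ v) ⟧) (toList p)          ≡⟨ ∑-map _ toℕ (toList p) ⟨
  occurrences (toℕ v) (toWord p)                         ∎
  where open ≡-Reasoning

evenDegreeVertices≡evenCount : ∀ {n} (p : Vec (Fin (suc n)) n) → evenDegreeVertices p ≡ evenCount n (toWord p)
evenDegreeVertices≡evenCount {n} p =
  trans (count≡∑ (λ v → 2 ∣? degree p v) (allFin (suc n)))
    (trans (∑-cong (allFin (suc n)) (λ {v} _ → cong (⟦_⟧ ∘ even) (degree≡occurrences p v)))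
      (∑-allFin-toℕ (suc n) (λ v → ⟦ even (occurrences v (toWord p)) ⟧)))

∑-increasingTrees : ∀ n (f : ℕ → ℕ) →
  ∑ (f ∘ evenDegreeVertices) (filter isIncreasingParentMap? (allVecs (allFin (suc n)) n))
    ≡ ∑ (f ∘ evenCount n) (parentWords 1 n)
∑-increasingTrees n f = begin
  ∑ (f ∘ evenDegreeVertices) (filter isIncreasingParentMap? vecs)
    ≡⟨ ∑-filter isIncreasingParentMap? (f ∘ evenDegreeVertices) vecs ⟩
  ∑ (λ p → ⟦ does (isIncreasingParentMap? p) ⟧ * f (evenDegreeVertices p)) vecs
    ≡⟨ ∑-cong vecs (λ {p} _ → cong₂ (λ b e → ⟦ b ⟧ * f e)
         (does-⇔ (isParentWord-lookup p 1) (isIncreasingParentMap? p) (T? _))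
         (evenDegreeVertices≡evenCount p)) ⟩
  ∑ (g ∘ map toℕ ∘ toList) vecs            ≡⟨ ∑-allVecs toℕ g (allFin (suc n)) n ⟩
  ∑ g (words (map toℕ (allFin (suc n))) n) ≡⟨ cong (λ xs → ∑ g (words xs n)) (map-toℕ-allFin (suc n)) ⟩
  ∑ g (words (upTo (suc n)) n)             ≡⟨ ∑-isParentWord (suc n) 1 n (f ∘ evenCount n) ≤-refl ⟩
  ∑ (f ∘ evenCount n) (parentWords 1 n)    ∎
  where
  open ≡-Reasoning
  vecs = allVecs (allFin (suc n)) n
  g : List ℕ → ℕ
  g w = ⟦ isParentWord 1 w ⟧ * f (evenCount n w)

indicator : ℕ → ℕ → ℕ
indicator k e = ⟦ does (e ≟ k) ⟧

2*+1≡odd : ∀ k → 2 * k + 1 ≡ odd k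
2*+1≡odd k = trans (+-comm (2 * k) 1) (cong (λ t → suc (k + t)) (+-identityʳ k))

odd-injective : ∀ {p q} → odd p ≡ odd q → p ≡ q
odd-injective {p} {q} eq = *-cancelˡ-≡ p q 2
  (trans (cong (p +_) (+-identityʳ p)) (trans (suc-injective eq) (cong (q +_) (sym (+-identityʳ q)))))

indicator-odd : ∀ k p → indicator k p ≡ indicator (2 * k + 1) (odd p)
indicator-odd k p = cong ⟦_⟧ (does-⇔ (mk⇔ to from) (p ≟ k) (odd p ≟ 2 * k + 1))
  where
  to : p ≡ k → odd p ≡ 2 * k + 1
  to refl = sym (2*+1≡odd k)
  from : odd p ≡ 2 * k + 1 → p ≡ k
  from eq = odd-injective (trans eq (2*+1≡odd k))

-- The identity also holds for n = 0.
theorem5p1 : ∀ (n k : ℕ) → 1 ≤ n →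
    numPermsWithExtPeaks n k ≡ numIncTreesWithEvenDeg n (2 * k + 1)
theorem5p1 n k _ = begin
  numPermsWithExtPeaks n k                         ≡⟨ count≡∑ (λ π → exteriorPeaks π ≟ k) perms ⟩
  ∑ (indicator k ∘ exteriorPeaks) perms            ≡⟨ ∑-permutations n (indicator k) ⟩
  ∑ (indicator k ∘ peaksFrom true) (permutationWords n)
    ≡⟨ ∑-cong (permutationWords n) (λ {σ} _ → indicator-odd k (peaksFrom true σ)) ⟩
  ∑ (indicator (2 * k + 1) ∘ odd ∘ peaksFrom true) (permutationWords n)
    ≡⟨ ∑-evenCount≡∑-peaks n (indicator (2 * k + 1)) ⟨
  ∑ (indicator (2 * k + 1) ∘ evenCount n) (parentWords 1 n)
    ≡⟨ ∑-increasingTrees n (indicator (2 * k + 1)) ⟨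
  ∑ (indicator (2 * k + 1) ∘ evenDegreeVertices) trees
    ≡⟨ count≡∑ (λ p → evenDegreeVertices p ≟ 2 * k + 1) trees ⟨
  numIncTreesWithEvenDeg n (2 * k + 1)             ∎
  where
  open ≡-Reasoning
  perms = filter isPerm? (allVecs (allFin n) n)
  trees = filter isIncreasingParentMap? (allVecs (allFin (suc n)) n)
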